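{- Let $\mathbb{F}$ be a field, $U\subseteq\mathbb{F}^n$ a linear code, and $U^\perp$ its orthogonal complement with respect to the Euclidean inner product $\sum_i x_iy_i$. If $I\subseteq\{1,\dots,n\}$ is an information set for the hull $U\cap U^\perp$, then the shortened code $$\mathcal{S}_I(U)=\{u\in U : u_i=0 \text{ for all } i\in I\}$$ has trivial hull, i.e. $\mathcal{S}_I(U)\cap \mathcal{S}_I(U)^\perp=\{0\}$.
   Context: A set $I\subseteq\{1,\dots,n\}$ is an information set for a linear code $C\subseteq\mathbb{F}^n$ if there exists a generator matrix of $C$ (matrix whose rows form a basis of $C$) whose restriction to the columns indexed by $I$ is the identity matrix (so $|I|=\dim C$). -}

module Defs where

open import Level using (Level; _⊔_; suc)
open import Data.Nat.Base using (ℕ)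
open import Data.Fin.Base using (Fin)
open import Data.Product using (Σ; ∃; _×_)
open import Data.Vec.Functional using (Vector)
open import Relation.Nullary using (¬_)
open import Relation.Unary using (Pred)
open import Relation.Binary.PropositionalEquality using (_≡_)
open import Function.Definitions using (Injective)
open import Algebra.Bundles using (CommutativeRing)
import Algebra.Definitions.RawMonoid as RawMonoidDefs

record Field (c ℓ : Level) : Set (suc (c ⊔ ℓ)) where
  field
    commutativeRing : CommutativeRing c ℓ
  open CommutativeRing commutativeRing public
  field
    1≉0     : ¬ (1# ≈ 0#)
    inverse : ∀ x → ¬ (x ≈ 0#) → Σ Carrier (λ y → (x * y) ≈ 1#)

module Codes {c ℓ : Level} (F : Field c ℓ) where
  open Field F
  open RawMonoidDefs +-rawMonoid using (sum)

  Vec : ℕ → Set c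
  Vec n = Vector Carrier n

  _≈ᵥ_ : ∀ {n} → Vec n → Vec n → Set ℓ
  x ≈ᵥ y = ∀ i → x i ≈ y i

  0ᵥ : ∀ {n} → Vec n
  0ᵥ _ = 0#

  _+ᵥ_ : ∀ {n} → Vec n → Vec n → Vec n
  (x +ᵥ y) i = x i + y i

  _·ᵥ_ : ∀ {n} → Carrier → Vec n → Vec n
  (a ·ᵥ x) i = a * x i

  ⟨_,_⟩ : ∀ {n} → Vec n → Vec n → Carrier
  ⟨ x , y ⟩ = sum (λ i → x i * y i)

  lincomb : ∀ {n k} → (Fin k → Carrier) → (Fin k → Vec n) → Vec n
  lincomb a G i = sum (λ j → a j * G j i)

  record IsLinearCode {n : ℕ} {p : Level} (C : Pred (Vec n) p) : Set (c ⊔ ℓ ⊔ p) where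
    field
      resp  : ∀ {x y} → x ≈ᵥ y → C x → C y
      has-zero : C 0ᵥ
      add   : ∀ {x y} → C x → C y → C (x +ᵥ y)
      scale : ∀ a {x} → C x → C (a ·ᵥ x)

  _⊥ : ∀ {n p} → Pred (Vec n) p → Pred (Vec n) (c ⊔ ℓ ⊔ p)
  (C ⊥) x = ∀ y → C y → ⟨ x , y ⟩ ≈ 0#

  Hull : ∀ {n p} → Pred (Vec n) p → Pred (Vec n) (c ⊔ ℓ ⊔ p)
  Hull C x = C x × (C ⊥) x

  IsBasis : ∀ {n k p} → Pred (Vec n) p → (Fin k → Vec n) → Set (c ⊔ ℓ ⊔ p)
  IsBasis {k = k} C G =
    (∀ j → C (G j))
    × (∀ (a : Fin k → Carrier) → lincomb a G ≈ᵥ 0ᵥ → ∀ j → a j ≈ 0#)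
    × (∀ x → C x → Σ (Fin k → Carrier) (λ a → x ≈ᵥ lincomb a G))


  -- I ⊆ {1..n}, |I| = k, is given by an injective enumeration ι : Fin k → Fin n.
  -- I is an information set for C if some generator matrix G (k×n, rows a basis
  -- of C) restricted to the columns ι(0),…,ι(k-1) is the k×k identity matrix.
  IsInformationSet : ∀ {n k p} → Pred (Vec n) p → (Fin k → Fin n) → Set (c ⊔ ℓ ⊔ p)
  IsInformationSet {n} {k} C ι =
    Injective _≡_ _≡_ ι
    × Σ (Fin k → Vec n) (λ G →
        IsBasis C G
        × (∀ j → G j (ι j) ≈ 1#)
        × (∀ j l → ¬ (j ≡ l) → G j (ι l) ≈ 0#))

  Shortened : ∀ {n k p} → Pred (Vec n) p → (Fin k → Fin n) → Pred (Vec n) (ℓ ⊔ p)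
  Shortened C ι u = C u × (∀ l → u (ι l) ≈ 0#)

  HasTrivialHull : ∀ {n p} → Pred (Vec n) p → Set (c ⊔ ℓ ⊔ p)
  HasTrivialHull C = ∀ x → Hull C x → x ≈ᵥ 0ᵥ

-- Let G be a generator matrix of the hull that is the identity on the columns I.  Every u ∈ U
-- splits as (u − v) + v, where v = Σ_l u_{ι l} G_l lies in the hull and u − v vanishes on I.
-- Hence a vector x ∈ U orthogonal to S_I(U) is orthogonal to all of U, so a vector in the hull of
-- S_I(U) lies in the hull of U; there it is determined by its coordinates on I, which vanish.
module Submission where

open import Defs
open import Level using (Level)
open import Data.Nat.Base as ℕ using (ℕ)
open import Data.Fin.Base as Fin using (Fin; punchIn)
open import Data.Fin.Properties using (punchInᵢ≢i)
open import Data.Product using (Σ-syntax; _×_; _,_; proj₁; proj₂)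
open import Relation.Nullary using (¬_)
open import Relation.Unary using (Pred; _⊆_)
open import Relation.Binary.PropositionalEquality using (_≡_)
import Algebra.Properties.Ring as RingProperties
import Algebra.Properties.Semiring.Sum as SemiringSum
import Relation.Binary.Reasoning.Setoid as SetoidReasoning

module _ {c ℓ : Level} (F : Field c ℓ) where
  open Field F
  open Codes F
  open SemiringSum semiring
    using (sum; sum-cong-≋; sum-replicate-zero; sum-remove; ∑-distrib-+; *-distribˡ-sum)
  open RingProperties ring using (-1*x≈-x)
  open SetoidReasoning setoid

  sum-≈0 : ∀ {m} (f : Fin m → Carrier) → (∀ i → f i ≈ 0#) → sum f ≈ 0#
  sum-≈0 {m} f f≈0 = trans (sum-cong-≋ f≈0) (sum-replicate-zero m)

  sum-single : ∀ {m} (f : Fin m → Carrier) (j : Fin m) →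
               (∀ l → ¬ l ≡ j → f l ≈ 0#) → sum f ≈ f j
  sum-single {ℕ.suc m} f j others≈0 = begin
    sum f                                ≈⟨ sum-remove f ⟩
    f j + sum (λ l → f (punchIn j l))   ≈⟨ +-congˡ (sum-≈0 _ (λ l → others≈0 _ (punchInᵢ≢i j l))) ⟩
    f j + 0#                             ≈⟨ +-identityʳ (f j) ⟩
    f j                                  ∎

  module _ {n : ℕ} where

    ⟨⟩-comm : (x y : Vec n) → ⟨ x , y ⟩ ≈ ⟨ y , x ⟩
    ⟨⟩-comm x y = sum-cong-≋ (λ i → *-comm (x i) (y i))

    ⟨⟩-congˡ : ∀ {x y} (z : Vec n) → x ≈ᵥ y → ⟨ x , z ⟩ ≈ ⟨ y , z ⟩
    ⟨⟩-congˡ z x≈y = sum-cong-≋ (λ i → *-congʳ (x≈y i))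

    ⟨⟩-zeroˡ : (y : Vec n) → ⟨ 0ᵥ , y ⟩ ≈ 0#
    ⟨⟩-zeroˡ y = sum-≈0 _ (λ i → zeroˡ (y i))

    ⟨⟩-distribˡ-+ᵥ : (x y z : Vec n) → ⟨ x +ᵥ y , z ⟩ ≈ ⟨ x , z ⟩ + ⟨ y , z ⟩
    ⟨⟩-distribˡ-+ᵥ x y z = trans (sum-cong-≋ (λ i → distribʳ (z i) (x i) (y i)))
                                 (∑-distrib-+ (λ i → x i * z i) (λ i → y i * z i))

    ⟨⟩-homoˡ-·ᵥ : ∀ a (x y : Vec n) → ⟨ a ·ᵥ x , y ⟩ ≈ a * ⟨ x , y ⟩
    ⟨⟩-homoˡ-·ᵥ a x y = trans (sum-cong-≋ (λ i → *-assoc a (x i) (y i)))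
                              (sym (*-distribˡ-sum a (λ i → x i * y i)))

    ⟨⟩-distribʳ-+ᵥ : (x y z : Vec n) → ⟨ x , y +ᵥ z ⟩ ≈ ⟨ x , y ⟩ + ⟨ x , z ⟩
    ⟨⟩-distribʳ-+ᵥ x y z = begin
      ⟨ x , y +ᵥ z ⟩          ≈⟨ ⟨⟩-comm x (y +ᵥ z) ⟩
      ⟨ y +ᵥ z , x ⟩          ≈⟨ ⟨⟩-distribˡ-+ᵥ y z x ⟩
      ⟨ y , x ⟩ + ⟨ z , x ⟩   ≈⟨ +-cong (⟨⟩-comm y x) (⟨⟩-comm z x) ⟩
      ⟨ x , y ⟩ + ⟨ x , z ⟩   ∎

    ⊥-flip : ∀ {p} {C : Pred (Vec n) p} {x y} → (C ⊥) y → C x → ⟨ x , y ⟩ ≈ 0#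
    ⊥-flip {x = x} {y} y⊥C x∈C = trans (⟨⟩-comm x y) (y⊥C x x∈C)

    ⊥-isLinearCode : ∀ {p} (C : Pred (Vec n) p) → IsLinearCode (C ⊥)
    ⊥-isLinearCode C = record
      { resp     = λ {x} x≈y x⊥C z z∈C → trans (sym (⟨⟩-congˡ z x≈y)) (x⊥C z z∈C)
      ; has-zero = λ z _ → ⟨⟩-zeroˡ z
      ; add      = λ {x} {y} x⊥C y⊥C z z∈C → begin
          ⟨ x +ᵥ y , z ⟩          ≈⟨ ⟨⟩-distribˡ-+ᵥ x y z ⟩
          ⟨ x , z ⟩ + ⟨ y , z ⟩   ≈⟨ +-cong (x⊥C z z∈C) (y⊥C z z∈C) ⟩
          0# + 0#                 ≈⟨ +-identityˡ 0# ⟩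
          0#                      ∎
      ; scale    = λ a {x} x⊥C z z∈C → begin
          ⟨ a ·ᵥ x , z ⟩   ≈⟨ ⟨⟩-homoˡ-·ᵥ a x z ⟩
          a * ⟨ x , z ⟩    ≈⟨ *-congˡ (x⊥C z z∈C) ⟩
          a * 0#           ≈⟨ zeroʳ a ⟩
          0#               ∎
      }

    Hull-isLinearCode : ∀ {p} {C : Pred (Vec n) p} → IsLinearCode C → IsLinearCode (Hull C)
    Hull-isLinearCode {C = C} C-lin = record
      { resp     = λ x≈y (x∈C , x⊥C) → C.resp x≈y x∈C , C⊥.resp x≈y x⊥C
      ; has-zero = C.has-zero , C⊥.has-zero
      ; add      = λ (x∈C , x⊥C) (y∈C , y⊥C) → C.add x∈C y∈C , C⊥.add x⊥C y⊥C
      ; scale    = λ a (x∈C , x⊥C) → C.scale a x∈C , C⊥.scale a x⊥C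
      }
      where
      module C  = IsLinearCode C-lin
      module C⊥ = IsLinearCode (⊥-isLinearCode C)

    lincomb-closed : ∀ {p k} {C : Pred (Vec n) p} → IsLinearCode C →
                     (a : Fin k → Carrier) (G : Fin k → Vec n) → (∀ j → C (G j)) → C (lincomb a G)
    lincomb-closed {k = ℕ.zero}  C-lin a G G∈C = IsLinearCode.has-zero C-lin
    lincomb-closed {k = ℕ.suc k} C-lin a G G∈C =
      add (scale (a Fin.zero) (G∈C Fin.zero))
          (lincomb-closed C-lin (λ j → a (Fin.suc j)) (λ j → G (Fin.suc j)) (λ j → G∈C (Fin.suc j)))
      where open IsLinearCode C-lin

    _+ᶜ_ : ∀ {p q} → Pred (Vec n) p → Pred (Vec n) q → Pred (Vec n) _
    (D +ᶜ E) u = Σ[ w ∈ Vec n ] Σ[ v ∈ Vec n ] D w × E v × u ≈ᵥ (w +ᵥ v)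

    ⊥-+ᶜ : ∀ {p q} {D : Pred (Vec n) p} {E : Pred (Vec n) q} {x} →
           (D ⊥) x → (E ⊥) x → ((D +ᶜ E) ⊥) x
    ⊥-+ᶜ {x = x} x⊥D x⊥E u (w , v , w∈D , v∈E , u≈w+v) = begin
      ⟨ x , u ⟩               ≈⟨ ⟨⟩-comm x u ⟩
      ⟨ u , x ⟩               ≈⟨ ⟨⟩-congˡ x u≈w+v ⟩
      ⟨ w +ᵥ v , x ⟩          ≈⟨ ⟨⟩-comm (w +ᵥ v) x ⟩
      ⟨ x , w +ᵥ v ⟩          ≈⟨ ⟨⟩-distribʳ-+ᵥ x w v ⟩
      ⟨ x , w ⟩ + ⟨ x , v ⟩   ≈⟨ +-cong (x⊥D w w∈D) (x⊥E v v∈E) ⟩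
      0# + 0#                 ≈⟨ +-identityˡ 0# ⟩
      0#                      ∎

    lincomb-at-columns : ∀ {k} {G : Fin k → Vec n} {ι : Fin k → Fin n} →
                         (∀ j → G j (ι j) ≈ 1#) → (∀ j l → ¬ j ≡ l → G j (ι l) ≈ 0#) →
                         ∀ a m → lincomb a G (ι m) ≈ a m
    lincomb-at-columns {G = G} {ι} diag≈1 offdiag≈0 a m = begin
      lincomb a G (ι m)   ≈⟨ sum-single _ m (λ l l≢m → trans (*-congˡ (offdiag≈0 l m l≢m)) (zeroʳ (a l))) ⟩
      a m * G m (ι m)     ≈⟨ *-congˡ (diag≈1 m) ⟩
      a m * 1#            ≈⟨ *-identityʳ (a m) ⟩
      a m                 ∎

    module _ {p k} {D : Pred (Vec n) p} {ι : Fin k → Fin n} where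

      informationSet-vanishing⇒0 : IsInformationSet D ι →
                                   ∀ {x} → D x → (∀ l → x (ι l) ≈ 0#) → x ≈ᵥ 0ᵥ
      informationSet-vanishing⇒0 (_ , G , (_ , _ , D⊆span) , diag≈1 , offdiag≈0) {x} x∈D x|I≈0 i = begin
        x i               ≈⟨ x≈aG i ⟩
        lincomb a G i     ≈⟨ sum-≈0 _ (λ j → trans (*-congʳ (a≈0 j)) (zeroˡ (G j i))) ⟩
        0#                ∎
        where
        a = proj₁ (D⊆span x x∈D)
        x≈aG = proj₂ (D⊆span x x∈D)
        a≈0 : ∀ j → a j ≈ 0#
        a≈0 j = begin
          a j                 ≈⟨ lincomb-at-columns {G = G} {ι} diag≈1 offdiag≈0 a j ⟨
          lincomb a G (ι j)   ≈⟨ x≈aG (ι j) ⟨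
          x (ι j)             ≈⟨ x|I≈0 j ⟩
          0#                  ∎

      ⊆Shortened+ᶜ : IsInformationSet D ι → ∀ {q} {U : Pred (Vec n) q} →
                     IsLinearCode U → IsLinearCode D → D ⊆ U → U ⊆ Shortened U ι +ᶜ D
      ⊆Shortened+ᶜ (_ , G , (G∈D , _) , diag≈1 , offdiag≈0) U-lin D-lin D⊆U {u} u∈U =
        w , v , (w∈U , w|I≈0) , v∈D , u≈w+v
        where
        open IsLinearCode U-lin
        v = lincomb (λ l → u (ι l)) G
        v∈D = lincomb-closed D-lin _ G G∈D
        w = u +ᵥ ((- 1#) ·ᵥ v)
        w∈U = add u∈U (scale (- 1#) (D⊆U v∈D))
        w|I≈0 : ∀ l → w (ι l) ≈ 0#
        w|I≈0 l = begin
          u (ι l) + - 1# * v (ι l)   ≈⟨ +-congˡ (-1*x≈-x (v (ι l))) ⟩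
          u (ι l) + - v (ι l)        ≈⟨ +-congˡ (-‿cong (lincomb-at-columns {G = G} {ι} diag≈1 offdiag≈0 _ l)) ⟩
          u (ι l) + - u (ι l)        ≈⟨ -‿inverseʳ (u (ι l)) ⟩
          0#                         ∎
        u≈w+v : u ≈ᵥ (w +ᵥ v)
        u≈w+v i = sym (begin
          u i + - 1# * v i + v i   ≈⟨ +-congʳ (+-congˡ (-1*x≈-x (v i))) ⟩
          u i + - v i + v i        ≈⟨ +-assoc (u i) (- v i) (v i) ⟩
          u i + (- v i + v i)      ≈⟨ +-congˡ (-‿inverseˡ (v i)) ⟩
          u i + 0#                 ≈⟨ +-identityʳ (u i) ⟩
          u i                      ∎)

proposition3 : ∀ {c ℓ p : Level} (F : Field c ℓ) (n k : ℕ)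
                 (U : Pred (Codes.Vec F n) p) (ι : Fin k → Fin n) →
                 Codes.IsLinearCode F U →
                 Codes.IsInformationSet F (Codes.Hull F U) ι →
                 Codes.HasTrivialHull F (Codes.Shortened F U ι)
proposition3 F n k U ι U-lin I-info x ((x∈U , x|I≈0) , x⊥S) =
  informationSet-vanishing⇒0 F I-info (x∈U , x⊥U) x|I≈0
  where
  x⊥U : (Codes._⊥ F U) x
  x⊥U u u∈U = ⊥-+ᶜ F x⊥S (λ v v∈Hull → ⊥-flip F (proj₂ v∈Hull) x∈U)
                 u (⊆Shortened+ᶜ F I-info U-lin (Hull-isLinearCode F U-lin) proj₁ u∈U)
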